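{- Let $S$ be a connected graph. Then every connected $S$-free graph $G$ satisfies $\kappa(G)=\delta(G)$ if and only if $S$ is an induced subgraph of $P_3$.
   Context: All graphs are finite and simple. A graph $G$ is $S$-free if $G$ contains no induced subgraph isomorphic to $S$. $\kappa(G)$ denotes the (vertex-)connectivity of $G$ and $\delta(G)$ its minimum degree. $P_i$ denotes the path with $i$ vertices. -}

module Defs where

open import Data.Nat using (ℕ; _≤_)
open import Data.Fin using (Fin; zero; suc)
open import Data.Fin.Subset using (Subset; _∈_; _∉_; ∣_∣; ∁; ⊥)
open import Data.Vec using (tabulate)
open import Data.Bool using (Bool; true; false)
open import Data.Product using (Σ; ∃; _×_)
open import Data.Sum using (_⊎_)
open import Relation.Nullary using (¬_)
open import Relation.Binary.PropositionalEquality using (_≡_; refl)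
open import Function.Definitions using (Injective)

record Graph : Set where
  field
    n      : ℕ
    adj    : Fin n → Fin n → Bool
    sym    : ∀ u v → adj u v ≡ adj v u
    irrefl : ∀ v → adj v v ≡ false
open Graph public

N : (G : Graph) → Fin (n G) → Subset (n G)
N G v = tabulate (adj G v)

deg : (G : Graph) → Fin (n G) → ℕ
deg G v = ∣ N G v ∣

IsMinDegree : Graph → ℕ → Set
IsMinDegree G k = (∃ λ v → deg G v ≡ k) × (∀ v → k ≤ deg G v)

data Reach (G : Graph) (X : Subset (n G)) : Fin (n G) → Fin (n G) → Set where
  here : ∀ {u} → u ∉ X → Reach G X u u
  step : ∀ {u w v} → u ∉ X → adj G u w ≡ true → Reach G X w v → Reach G X u v

Connected : Graph → Set
Connected G = (1 ≤ n G) × (∀ u v → Reach G ⊥ u v)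

Separating : (G : Graph) → Subset (n G) → Set
Separating G X =
  (∃ λ u → ∃ λ v → u ∉ X × v ∉ X × ¬ Reach G X u v) ⊎ (∣ ∁ X ∣ ≤ 1)

-- κ(G) = k : minimum size of a vertex set whose deletion disconnects G
-- or leaves at most one vertex (so κ(K_n) = n - 1)
IsConnectivity : Graph → ℕ → Set
IsConnectivity G k =
  (∃ λ X → ∣ X ∣ ≡ k × Separating G X) × (∀ X → Separating G X → k ≤ ∣ X ∣)

KappaEqDelta : Graph → Set
KappaEqDelta G = ∃ λ k → IsConnectivity G k × IsMinDegree G k

_≤ᵢ_ : Graph → Graph → Set
H ≤ᵢ G = Σ (Fin (n H) → Fin (n G)) λ f →
  Injective _≡_ _≡_ f × (∀ u v → adj H u v ≡ adj G (f u) (f v))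

Free : Graph → Graph → Set
Free S G = ¬ (S ≤ᵢ G)

p3adj : Fin 3 → Fin 3 → Bool
p3adj zero (suc zero) = true
p3adj (suc zero) zero = true
p3adj (suc zero) (suc (suc zero)) = true
p3adj (suc (suc zero)) (suc zero) = true
p3adj _ _ = false

p3sym : ∀ u v → p3adj u v ≡ p3adj v u
p3sym zero zero = refl
p3sym zero (suc zero) = refl
p3sym zero (suc (suc zero)) = refl
p3sym (suc zero) zero = refl
p3sym (suc zero) (suc zero) = refl
p3sym (suc zero) (suc (suc zero)) = refl
p3sym (suc (suc zero)) zero = refl
p3sym (suc (suc zero)) (suc zero) = refl
p3sym (suc (suc zero)) (suc (suc zero)) = refl

p3irr : ∀ v → p3adj v v ≡ false
p3irr zero = refl
p3irr (suc zero) = refl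
p3irr (suc (suc zero)) = refl

P3 : Graph
P3 = record { n = 3 ; adj = p3adj ; sym = p3sym ; irrefl = p3irr }

module Submission where

-- (⇐) An S-free graph with S ≤ᵢ P3 is P3-free; a connected P3-free graph is
--     complete (induction along a walk), and a complete graph has κ = δ = n - 1.
-- (⇒) The double square (two 4-cycles sharing a vertex) and the bowtie (two
--     triangles sharing a vertex) are connected with κ = 1 < 2 ≤ δ, so S lies
--     (up to double negation) in both.  The double square is bipartite, so S is
--     triangle-free.  Were S to have four vertices, pigeonhole would put two in
--     one wing of the bowtie; they are adjacent true twins, which no walk of a
--     triangle-free graph can leave, so S would have two vertices.  Thus S has
--     at most three vertices, and such graphs embed in P3 by inspection.

open import Defs
open import Function.Base using (_∘_)
open import Function.Bundles using (_⇔_; mk⇔; Equivalence)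
open import Function.Definitions using (Injective)
open import Data.Nat using (ℕ; zero; suc; _≤_; _<_; _∸_; _+_; z≤n; s≤s; s≤s⁻¹; _<?_)
open import Data.Nat.Properties
  using (≤-trans; ≤-reflexive; suc-injective; ≤⇒≯; ≮⇒≥; <-trans; n<1+n; m+n∸n≡m;
         m≤n+m∸n; +-monoʳ-≤; +-comm; module ≤-Reasoning)
open import Data.Fin using (Fin; zero; suc; #_; fromℕ<; inject₁)
open import Data.Fin.Properties
  using (_≟_; all?; any?; pigeonhole; injective⇒≤; inject₁-injective; <⇒≢; toℕ<n)
import Data.Fin.Properties as Fin
open import Data.Fin.Subset using (Subset; _∉_; ∣_∣; ∁; ⁅_⁆) renaming (⊥ to ∅)
open import Data.Fin.Subset.Properties using (∉⊥; ∣∁p∣≡n∸∣p∣; ∣⁅x⁆∣≡1; x∈⁅y⁆⇔x≡y; x≢y⇒x∉⁅y⁆)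
open import Data.Vec using (tabulate; lookup; _∷_; [])
open import Data.List using (List)
import Data.List as List
open import Data.Bool using (Bool; true; false; not; _∧_; _∨_)
open import Data.Bool.ListAction using (any)
import Data.Bool.Properties as Bool
open import Data.Product using (∃; ∃-syntax; _×_; _,_; proj₁; proj₂)
open import Data.Sum using (_⊎_; inj₁; inj₂; [_,_])
open import Data.Empty using (⊥; ⊥-elim)
open import Relation.Nullary using (¬_; Dec; yes; no)
open import Relation.Nullary.Decidable
  using (True; from-yes; toWitness; does; ¬?; _×-dec_; _⊎-dec_; _→-dec_)
open import Relation.Binary.PropositionalEquality using (_≡_; _≢_; refl; trans; cong; subst)
import Relation.Binary.PropositionalEquality as ≡

reach-start : ∀ {G X u v} → Reach G X u v → u ∉ X
reach-start (here u∉X)     = u∉X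
reach-start (step u∉X _ _) = u∉X

reach-++ : ∀ {G X u v w} → Reach G X u v → Reach G X v w → Reach G X u w
reach-++ (here _)         q = q
reach-++ (step u∉X uw p) q = step u∉X uw (reach-++ p q)

-- A labelling that is constant on every edge of G - X is constant along the
-- walks of G - X; this certifies that X separates differently labelled vertices.
reach-invariant : ∀ {G X} {A : Set} (label : Fin (n G) → A) →
  (∀ u w → u ∉ X → w ∉ X → adj G u w ≡ true → label u ≡ label w) →
  ∀ {u v} → Reach G X u v → label u ≡ label v
reach-invariant label constant (here _) = refl
reach-invariant label constant (step u∉X uw p) =
  trans (constant _ _ u∉X (reach-start p) uw) (reach-invariant label constant p)

not-isolated : (G : Graph) → Connected G → ∀ {u v} → u ≢ v → ¬ (∀ w → adj G u w ≡ false)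
not-isolated G (_ , walks) {u} {v} u≢v isolated with walks u v
... | here _ = u≢v refl
... | step {w = w} _ uw _ with trans (≡.sym uw) (isolated w)
...   | ()

≤ᵢ-trans : (S H G : Graph) → S ≤ᵢ H → H ≤ᵢ G → S ≤ᵢ G
≤ᵢ-trans S H G (f , f-inj , f-adj) (g , g-inj , g-adj) =
  g ∘ f , (λ eq → f-inj (g-inj eq)) , λ u v → trans (f-adj u v) (g-adj (f u) (f v))

adjacent⇒distinct : (G : Graph) → ∀ {u v} → adj G u v ≡ true → u ≢ v
adjacent⇒distinct G {u} uv refl with trans (≡.sym uv) (irrefl G u)
... | ()

triple-embedding : (a : Fin 3 → Fin 3 → Bool) (a-sym : ∀ u v → a u v ≡ a v u)
  (a-irr : ∀ v → a v v ≡ false) (G : Graph) (x y z : Fin (n G)) →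
  x ≢ y → x ≢ z → y ≢ z →
  a zero (suc zero) ≡ adj G x y → a zero (suc (suc zero)) ≡ adj G x z →
  a (suc zero) (suc (suc zero)) ≡ adj G y z →
  record { n = 3 ; adj = a ; sym = a-sym ; irrefl = a-irr } ≤ᵢ G
triple-embedding a a-sym a-irr G x y z x≢y x≢z y≢z axy axz ayz = h , h-inj , h-adj
  where
  h : Fin 3 → Fin (n G)
  h zero             = x
  h (suc zero)       = y
  h (suc (suc zero)) = z

  h-inj : Injective _≡_ _≡_ h
  h-inj {zero}             {zero}             _  = refl
  h-inj {zero}             {suc zero}         eq = ⊥-elim (x≢y eq)
  h-inj {zero}             {suc (suc zero)}   eq = ⊥-elim (x≢z eq)
  h-inj {suc zero}         {zero}             eq = ⊥-elim (x≢y (≡.sym eq))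
  h-inj {suc zero}         {suc zero}         _  = refl
  h-inj {suc zero}         {suc (suc zero)}   eq = ⊥-elim (y≢z eq)
  h-inj {suc (suc zero)}   {zero}             eq = ⊥-elim (x≢z (≡.sym eq))
  h-inj {suc (suc zero)}   {suc zero}         eq = ⊥-elim (y≢z (≡.sym eq))
  h-inj {suc (suc zero)}   {suc (suc zero)}   _  = refl

  diagonal : ∀ u → a u u ≡ adj G (h u) (h u)
  diagonal u = trans (a-irr u) (≡.sym (irrefl G (h u)))

  flipped : ∀ {u v} → a u v ≡ adj G (h u) (h v) → a v u ≡ adj G (h v) (h u)
  flipped {u} {v} e = trans (a-sym v u) (trans e (sym G (h u) (h v)))

  h-adj : ∀ u v → a u v ≡ adj G (h u) (h v)
  h-adj zero             zero             = diagonal zero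
  h-adj zero             (suc zero)       = axy
  h-adj zero             (suc (suc zero)) = axz
  h-adj (suc zero)       zero             = flipped axy
  h-adj (suc zero)       (suc zero)       = diagonal (suc zero)
  h-adj (suc zero)       (suc (suc zero)) = ayz
  h-adj (suc (suc zero)) zero             = flipped axz
  h-adj (suc (suc zero)) (suc zero)       = flipped ayz
  h-adj (suc (suc zero)) (suc (suc zero)) = diagonal (suc (suc zero))

-- Three pairwise adjacent vertices (distinct, by irreflexivity).
Triangle : Graph → Set
Triangle G = ∃[ p ] ∃[ q ] ∃[ r ] (adj G p q ≡ true × adj G q r ≡ true × adj G p r ≡ true)

triangle-image : (S G : Graph) → S ≤ᵢ G → Triangle S → Triangle G
triangle-image S G (f , _ , f-adj) (p , q , r , pq , qr , pr) =
  f p , f q , f r , moved pq , moved qr , moved pr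
  where
  moved : ∀ {u v} → adj S u v ≡ true → adj G (f u) (f v) ≡ true
  moved {u} {v} e = trans (≡.sym (f-adj u v)) e

ProperColouring : (G : Graph) → (Fin (n G) → Bool) → Set
ProperColouring G colour = ∀ u v → adj G u v ≡ true → colour u ≡ not (colour v)

-- A properly 2-coloured graph has no triangle: going around a triangle the
-- colour would flip three times and return to its start.
2-colourable⇒triangle-free : (G : Graph) (colour : Fin (n G) → Bool) →
  ProperColouring G colour → ¬ Triangle G
2-colourable⇒triangle-free G colour proper (p , q , r , pq , qr , pr) =
  Bool.not-¬ p≡r (proper p r pr)
  where
  p≡r : colour p ≡ colour r
  p≡r = begin
    colour p             ≡⟨ proper p q pq ⟩
    not (colour q)       ≡⟨ cong not (proper q r qr) ⟩
    not (not (colour r)) ≡⟨ Bool.not-involutive (colour r) ⟩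
    colour r             ∎
    where open ≡.≡-Reasoning

TrueTwins : (G : Graph) → Fin (n G) → Fin (n G) → Set
TrueTwins G x y = adj G x y ≡ true × (∀ z → z ≢ x → z ≢ y → adj G x z ≡ adj G y z)

twins-pullback : (S G : Graph) (e : S ≤ᵢ G) → ∀ {i j} →
  TrueTwins G (proj₁ e i) (proj₁ e j) → TrueTwins S i j
twins-pullback S G (f , f-inj , f-adj) {i} {j} (fij , alike) =
  trans (f-adj i j) fij ,
  λ z z≢i z≢j → trans (f-adj i z)
    (trans (alike (f z) (z≢i ∘ f-inj) (z≢j ∘ f-inj)) (≡.sym (f-adj j z)))

-- In a triangle-free graph a walk starting at one of two adjacent true twins
-- never leaves them: the first step to a third vertex w would make w adjacent
-- to both twins.
twins-trap : (S : Graph) → ¬ Triangle S → ∀ {i j} → TrueTwins S i j →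
  ∀ {u v} → Reach S ∅ u v → u ≡ i ⊎ u ≡ j → v ≡ i ⊎ v ≡ j
twins-trap S no-triangle twins (here _) u∈ij = u∈ij
twins-trap S no-triangle {i} {j} twins@(ij , alike) (step {w = w} _ uw walk) u∈ij
  with w ≟ i | w ≟ j
... | yes w≡i | _       = twins-trap S no-triangle twins walk (inj₁ w≡i)
... | no _    | yes w≡j = twins-trap S no-triangle twins walk (inj₂ w≡j)
... | no w≢i  | no w≢j  = ⊥-elim (no-triangle (i , j , w , ij , jw , iw))
  where
  iw : adj S i w ≡ true
  iw = [ (λ { refl → uw }) , (λ { refl → trans (alike w w≢i w≢j) uw }) ] u∈ij
  jw : adj S j w ≡ true
  jw = trans (≡.sym (alike w w≢i w≢j)) iw

covered-by-two : ∀ {m} (i j : Fin m) → (∀ v → v ≡ i ⊎ v ≡ j) → m ≤ 2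
covered-by-two {m} i j cover = injective⇒≤ {f = is-i} is-i-injective
  where
  is-i : Fin m → Fin 2
  is-i v with v ≟ i
  ... | yes _ = zero
  ... | no _  = suc zero

  other : ∀ {v} → v ≢ i → v ≡ j
  other {v} v≢i = [ (λ v≡i → ⊥-elim (v≢i v≡i)) , (λ v≡j → v≡j) ] (cover v)

  is-i-injective : Injective _≡_ _≡_ is-i
  is-i-injective {x} {y} eq with x ≟ i | y ≟ i
  ... | yes x≡i | yes y≡i = trans x≡i (≡.sym y≡i)
  ... | no x≢i  | no y≢i  = trans (other x≢i) (≡.sym (other y≢i))
  is-i-injective () | yes _ | no _
  is-i-injective () | no _  | yes _

-- In a connected P3-free graph any two distinct vertices are adjacent: along a
-- walk u → w → ⋯ → v, the vertex w is (inductively) adjacent to v, so u ≁ v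
-- would make u, w, v an induced P3.
P3-free⇒complete : (G : Graph) → ¬ (P3 ≤ᵢ G) →
  ∀ {u v} → Reach G ∅ u v → u ≢ v → adj G u v ≡ true
P3-free⇒complete G no-P3 (here _) u≢v = ⊥-elim (u≢v refl)
P3-free⇒complete G no-P3 {u} {v} (step {w = w} _ uw walk) u≢v with w ≟ v
... | yes refl = uw
... | no w≢v with adj G u v in uv
...   | true  = refl
...   | false = ⊥-elim (no-P3 (triple-embedding p3adj p3sym p3irr G u w v
                 (adjacent⇒distinct G uw) u≢v w≢v (≡.sym uw) (≡.sym uv) (≡.sym wv)))
  where
  wv : adj G w v ≡ true
  wv = P3-free⇒complete G no-P3 walk w≢v

all-true-count : ∀ {m} (f : Fin m → Bool) → (∀ u → f u ≡ true) → ∣ tabulate f ∣ ≡ m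
all-true-count {zero}  f _       = refl
all-true-count {suc m} f all-true rewrite all-true zero =
  cong suc (all-true-count (f ∘ suc) (all-true ∘ suc))

one-false-count : ∀ {m} (f : Fin m → Bool) (v : Fin m) → f v ≡ false →
  (∀ u → u ≢ v → f u ≡ true) → suc ∣ tabulate f ∣ ≡ m
one-false-count {suc m} f zero    fv others rewrite fv =
  cong suc (all-true-count (f ∘ suc) (λ u → others (suc u) (λ ())))
one-false-count {suc m} f (suc v) fv others rewrite others zero (λ ()) =
  cong suc (one-false-count (f ∘ suc) v fv
    (λ u u≢v → others (suc u) (u≢v ∘ Fin.suc-injective)))

-- A complete graph on n ≥ 1 vertices has κ = δ = n - 1: every degree is n - 1,
-- deleting a neighbourhood leaves one vertex, and a separating set of a complete
-- graph must leave at most one vertex.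
complete⇒κ≡δ : (G : Graph) → 1 ≤ n G → (∀ {u v} → u ≢ v → adj G u v ≡ true) →
  KappaEqDelta G
complete⇒κ≡δ G nonempty complete =
  δ , (separator , minimal) , (v₀ , refl) , λ v → ≤-reflexive (degrees-agree v)
  where
  v₀ : Fin (n G)
  v₀ = fromℕ< nonempty

  δ : ℕ
  δ = deg G v₀

  degree : ∀ v → suc (deg G v) ≡ n G
  degree v = one-false-count (adj G v) v (irrefl G v) (λ u u≢v → complete (u≢v ∘ ≡.sym))

  degrees-agree : ∀ v → δ ≡ deg G v
  degrees-agree v = suc-injective (trans (degree v₀) (≡.sym (degree v)))

  complement-size : ∀ Y → ∣ ∁ Y ∣ ≡ suc δ ∸ ∣ Y ∣
  complement-size Y = trans (∣∁p∣≡n∸∣p∣ Y) (cong (_∸ ∣ Y ∣) (≡.sym (degree v₀)))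

  separator : ∃ λ X → ∣ X ∣ ≡ δ × Separating G X
  separator = N G v₀ , refl ,
    inj₂ (≤-reflexive (trans (complement-size (N G v₀)) (m+n∸n≡m 1 δ)))

  minimal : ∀ Y → Separating G Y → δ ≤ ∣ Y ∣
  minimal Y (inj₁ (u , v , u∉Y , v∉Y , unreachable)) with u ≟ v
  ... | yes refl = ⊥-elim (unreachable (here u∉Y))
  ... | no u≢v   = ⊥-elim (unreachable (step u∉Y (complete u≢v) (here v∉Y)))
  minimal Y (inj₂ one-left) = s≤s⁻¹ (begin
    suc δ                  ≤⟨ m≤n+m∸n (suc δ) ∣ Y ∣ ⟩
    ∣ Y ∣ + (suc δ ∸ ∣ Y ∣) ≤⟨ +-monoʳ-≤ ∣ Y ∣ (subst (_≤ 1) (complement-size Y) one-left) ⟩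
    ∣ Y ∣ + 1              ≡⟨ +-comm ∣ Y ∣ 1 ⟩
    suc ∣ Y ∣              ∎)
    where open ≤-Reasoning

P3-subgraph⇒κ≡δ : (S : Graph) → S ≤ᵢ P3 →
  ∀ (G : Graph) → Connected G → Free S G → KappaEqDelta G
P3-subgraph⇒κ≡δ S S≤P3 G (nonempty , walks) S-free =
  complete⇒κ≡δ G nonempty λ {u} {v} →
    P3-free⇒complete G (λ P3≤G → S-free (≤ᵢ-trans S P3 G S≤P3 P3≤G)) (walks u v)

small-separator⇒κ≢δ : (G : Graph) (X : Subset (n G)) → Separating G X →
  (∀ v → ∣ X ∣ < deg G v) → ¬ KappaEqDelta G
small-separator⇒κ≢δ G X separating small (k , (_ , minimal) , (v , deg≡k) , _) =
  ≤⇒≯ (minimal X separating) (subst (∣ X ∣ <_) deg≡k (small v))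

Blocked : (G : Graph) → Fin (n G) → ∀ {k} → (Fin (n G) → Fin k) → Set
Blocked G c block = ∀ u w → u ≢ c → w ≢ c → adj G u w ≡ true → block u ≡ block w

cut-vertex⇒κ≢δ : (G : Graph) (c : Fin (n G)) {k : ℕ} (block : Fin (n G) → Fin k) →
  Blocked G c block → (u v : Fin (n G)) → u ≢ c → v ≢ c → block u ≢ block v →
  (∀ w → 1 < deg G w) → ¬ KappaEqDelta G
cut-vertex⇒κ≢δ G c block blocked u v u≢c v≢c different degrees =
  small-separator⇒κ≢δ G ⁅ c ⁆
    (inj₁ (u , v , x≢y⇒x∉⁅y⁆ u≢c , x≢y⇒x∉⁅y⁆ v≢c , different ∘ same-block))
    (λ w → subst (_< deg G w) (≡.sym (∣⁅x⁆∣≡1 c)) (degrees w))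
  where
  not-c : ∀ {x} → x ∉ ⁅ c ⁆ → x ≢ c
  not-c x∉c x≡c = x∉c (Equivalence.from x∈⁅y⁆⇔x≡y x≡c)

  same-block : Reach G ⁅ c ⁆ u v → block u ≡ block v
  same-block = reach-invariant block
    (λ x y x∉c y∉c xy → blocked x y (not-c x∉c) (not-c y∉c) xy)

Near : (G : Graph) → Fin (n G) → Fin (n G) → Set
Near G r v = v ≡ r ⊎ adj G r v ≡ true ⊎ ∃[ w ] (adj G r w ≡ true × adj G w v ≡ true)

centred⇒connected : (G : Graph) (r : Fin (n G)) → (∀ v → Near G r v) → Connected G
centred⇒connected G r near =
  ≤-trans (s≤s z≤n) (toℕ<n r) , λ u v → reach-++ (to-centre u) (from-centre v)
  where
  edge : ∀ {u w v} → adj G u w ≡ true → Reach G ∅ w v → Reach G ∅ u v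
  edge = step ∉⊥

  stay : ∀ {u} → Reach G ∅ u u
  stay = here ∉⊥

  back : ∀ {u v} → adj G u v ≡ true → adj G v u ≡ true
  back {u} {v} uv = trans (sym G v u) uv

  from-centre : ∀ v → Reach G ∅ r v
  from-centre v with near v
  ... | inj₁ refl                  = stay
  ... | inj₂ (inj₁ rv)             = edge rv stay
  ... | inj₂ (inj₂ (w , rw , wv)) = edge rw (edge wv stay)

  to-centre : ∀ u → Reach G ∅ u r
  to-centre u with near u
  ... | inj₁ refl                  = stay
  ... | inj₂ (inj₁ ru)             = edge (back ru) stay
  ... | inj₂ (inj₂ (w , rw , wu)) = edge (back wu) (edge (back rw) stay)

edge-adjacency : ∀ {m} → List (Fin m × Fin m) → Fin m → Fin m → Bool
edge-adjacency {m} edges u v = any joins edges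
  where
  joins : Fin m × Fin m → Bool
  joins (a , b) = (does (u ≟ a) ∧ does (v ≟ b)) ∨ (does (u ≟ b) ∧ does (v ≟ a))

-- A graph on Fin m whose symmetry and irreflexivity are verified by evaluation
-- (the implicit certificates are the unit type exactly when the checks succeed).
finite-graph : (m : ℕ) (a : Fin m → Fin m → Bool) →
  {_ : True (all? λ u → all? λ v → a u v Bool.≟ a v u)} →
  {_ : True (all? λ v → a v v Bool.≟ false)} → Graph
finite-graph m a {symmetric} {irreflexive} =
  record { n = m ; adj = a ; sym = toWitness symmetric ; irrefl = toWitness irreflexive }

near? : (G : Graph) (r v : Fin (n G)) → Dec (Near G r v)
near? G r v = v ≟ r ⊎-dec (adj G r v Bool.≟ true) ⊎-dec
  any? (λ w → (adj G r w Bool.≟ true) ×-dec (adj G w v Bool.≟ true))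

blocked? : (G : Graph) (c : Fin (n G)) {k : ℕ} (block : Fin (n G) → Fin k) →
  Dec (Blocked G c block)
blocked? G c block = all? λ u → all? λ w →
  ¬? (u ≟ c) →-dec ¬? (w ≟ c) →-dec (adj G u w Bool.≟ true) →-dec (block u ≟ block w)

proper? : (G : Graph) (colour : Fin (n G) → Bool) → Dec (ProperColouring G colour)
proper? G colour = all? λ u → all? λ v →
  (adj G u v Bool.≟ true) →-dec (colour u Bool.≟ not (colour v))

twins? : (G : Graph) (x y : Fin (n G)) → Dec (TrueTwins G x y)
twins? G x y = (adj G x y Bool.≟ true) ×-dec
  all? (λ z → ¬? (z ≟ x) →-dec ¬? (z ≟ y) →-dec (adj G x z Bool.≟ adj G y z))

DoubleSquare : Graph
DoubleSquare = finite-graph 7 (edge-adjacency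
  ((# 0 , # 1) List.∷ (# 1 , # 2) List.∷ (# 2 , # 3) List.∷ (# 3 , # 0) List.∷
   (# 0 , # 4) List.∷ (# 4 , # 5) List.∷ (# 5 , # 6) List.∷ (# 6 , # 0) List.∷ List.[]))

-- The two squares, as blocks with respect to the cut vertex 0.
square : Fin 7 → Fin 3
square = lookup (# 0 ∷ # 1 ∷ # 1 ∷ # 1 ∷ # 2 ∷ # 2 ∷ # 2 ∷ [])

square-colour : Fin 7 → Bool
square-colour = lookup (true ∷ false ∷ true ∷ false ∷ false ∷ true ∷ false ∷ [])

DoubleSquare-connected : Connected DoubleSquare
DoubleSquare-connected =
  centred⇒connected DoubleSquare (# 0) (from-yes (all? (near? DoubleSquare (# 0))))

DoubleSquare-κ≢δ : ¬ KappaEqDelta DoubleSquare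
DoubleSquare-κ≢δ = cut-vertex⇒κ≢δ DoubleSquare (# 0) square
  (from-yes (blocked? DoubleSquare (# 0) square)) (# 1) (# 4) (λ ()) (λ ()) (λ ())
  (from-yes (all? λ w → 1 <? deg DoubleSquare w))

DoubleSquare-triangle-free : ¬ Triangle DoubleSquare
DoubleSquare-triangle-free = 2-colourable⇒triangle-free DoubleSquare square-colour
  (from-yes (proper? DoubleSquare square-colour))

Bowtie : Graph
Bowtie = finite-graph 5 (edge-adjacency
  ((# 0 , # 1) List.∷ (# 1 , # 2) List.∷ (# 2 , # 0) List.∷
   (# 0 , # 3) List.∷ (# 3 , # 4) List.∷ (# 4 , # 0) List.∷ List.[]))

-- The wings {1, 2} and {3, 4} of the bowtie, and its centre 0.
wing : Fin 5 → Fin 3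
wing = lookup (# 0 ∷ # 1 ∷ # 1 ∷ # 2 ∷ # 2 ∷ [])

Bowtie-connected : Connected Bowtie
Bowtie-connected = centred⇒connected Bowtie (# 0) (from-yes (all? (near? Bowtie (# 0))))

Bowtie-κ≢δ : ¬ KappaEqDelta Bowtie
Bowtie-κ≢δ = cut-vertex⇒κ≢δ Bowtie (# 0) wing
  (from-yes (blocked? Bowtie (# 0) wing)) (# 1) (# 3) (λ ()) (λ ()) (λ ())
  (from-yes (all? λ w → 1 <? deg Bowtie w))

Bowtie-twins : ∀ x y → x ≢ y → wing x ≡ wing y → TrueTwins Bowtie x y
Bowtie-twins = from-yes (all? λ x → all? λ y →
  ¬? (x ≟ y) →-dec (wing x ≟ wing y) →-dec twins? Bowtie x y)

ForcesKappaEqDelta : Graph → Set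
ForcesKappaEqDelta S = ∀ (G : Graph) → Connected G → Free S G → KappaEqDelta G

forced-subgraph : (S : Graph) → ForcesKappaEqDelta S →
  (G : Graph) → Connected G → ¬ KappaEqDelta G → ¬ ¬ (S ≤ᵢ G)
forced-subgraph S forces G G-connected κ≢δ S-free = κ≢δ (forces G G-connected S-free)

-- Two distinct vertices of a connected triangle-free S that land in one wing of
-- the bowtie are adjacent true twins of S, which trap every walk from them:
-- so S has at most two vertices.
same-wing⇒at-most-two : (S : Graph) → Connected S → ¬ Triangle S → (e : S ≤ᵢ Bowtie) →
  ∀ {i j} → i ≢ j → wing (proj₁ e i) ≡ wing (proj₁ e j) → n S ≤ 2
same-wing⇒at-most-two S (_ , walks) no-triangle e {i} {j} i≢j same-wing =
  covered-by-two i j (λ v → twins-trap S no-triangle twins (walks i v) (inj₁ refl))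
  where
  twins : TrueTwins S i j
  twins = twins-pullback S Bowtie e (Bowtie-twins _ _ (i≢j ∘ proj₁ (proj₂ e)) same-wing)

-- A connected triangle-free induced subgraph of the bowtie has at most three
-- vertices: with four, pigeonhole puts two of them in the same wing.
bowtie-subgraph-small : (S : Graph) → Connected S → ¬ Triangle S → S ≤ᵢ Bowtie →
  ¬ (3 < n S)
bowtie-subgraph-small S S-connected no-triangle e big
  with pigeonhole big (wing ∘ proj₁ e)
... | i , j , i<j , same-wing =
  ≤⇒≯ (same-wing⇒at-most-two S S-connected no-triangle e (<⇒≢ i<j) same-wing)
      (<-trans (n<1+n 2) big)

-- A connected triangle-free graph on at most three vertices is an induced
-- subgraph of P3: on three vertices exactly two of the three pairs are edges,
-- and their common vertex is sent to the middle of P3.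
small⇒P3 : (S : Graph) → Connected S → ¬ Triangle S → n S ≤ 3 → S ≤ᵢ P3
small⇒P3 record { n = zero } (() , _) _ _
small⇒P3 record { n = suc zero ; adj = a ; irrefl = a-irr } _ _ _ =
  (λ _ → zero) , (λ { {zero} {zero} _ → refl }) , λ { zero zero → a-irr zero }
small⇒P3 S@record { n = suc (suc zero) ; adj = a ; sym = a-sym ; irrefl = a-irr }
  S-connected _ _
  with a zero (suc zero) in a01
... | true  = inject₁ , inject₁-injective , λ
  { zero zero → a-irr zero ; zero (suc zero) → a01
  ; (suc zero) zero → trans (a-sym _ _) a01 ; (suc zero) (suc zero) → a-irr (suc zero) }
... | false = ⊥-elim (not-isolated S S-connected {zero} {suc zero} (λ ())
    λ { zero → a-irr zero ; (suc zero) → a01 })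
small⇒P3 S@record { n = suc (suc (suc zero)) ; adj = a ; sym = a-sym ; irrefl = a-irr }
  S-connected no-triangle _
  with a zero (suc zero) in a01 | a zero (suc (suc zero)) in a02
     | a (suc zero) (suc (suc zero)) in a12
-- three edges form a triangle; two edges form a P3 around their common vertex;
-- with at most one edge some vertex is isolated.
... | true  | true  | true  = ⊥-elim (no-triangle (# 0 , # 1 , # 2 , a01 , a12 , a02))
... | true  | true  | false =
    triple-embedding a a-sym a-irr P3 (# 1) (# 0) (# 2) (λ ()) (λ ()) (λ ()) a01 a02 a12
... | true  | false | true  =
    triple-embedding a a-sym a-irr P3 (# 0) (# 1) (# 2) (λ ()) (λ ()) (λ ()) a01 a02 a12
... | false | true  | true  =
    triple-embedding a a-sym a-irr P3 (# 0) (# 2) (# 1) (λ ()) (λ ()) (λ ()) a01 a02 a12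
... | true  | false | false = ⊥-elim (not-isolated S S-connected {# 2} {# 0} (λ ())
    λ { zero → trans (a-sym _ _) a02 ; (suc zero) → trans (a-sym _ _) a12
      ; (suc (suc zero)) → a-irr (# 2) })
... | false | true  | false = ⊥-elim (not-isolated S S-connected {# 1} {# 0} (λ ())
    λ { zero → trans (a-sym _ _) a01 ; (suc zero) → a-irr (# 1) ; (suc (suc zero)) → a12 })
... | false | false | _     = ⊥-elim (not-isolated S S-connected {# 0} {# 1} (λ ())
    λ { zero → a-irr (# 0) ; (suc zero) → a01 ; (suc (suc zero)) → a02 })
small⇒P3 record { n = suc (suc (suc (suc _))) } _ _ (s≤s (s≤s (s≤s ())))

κ≡δ-forced⇒P3-subgraph : (S : Graph) → Connected S → ForcesKappaEqDelta S → S ≤ᵢ P3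
κ≡δ-forced⇒P3-subgraph S S-connected forces =
  small⇒P3 S S-connected triangle-free (≮⇒≥ few-vertices)
  where
  triangle-free : ¬ Triangle S
  triangle-free triangle =
    forced-subgraph S forces DoubleSquare DoubleSquare-connected DoubleSquare-κ≢δ
      (λ e → DoubleSquare-triangle-free (triangle-image S DoubleSquare e triangle))

  few-vertices : ¬ (3 < n S)
  few-vertices big =
    forced-subgraph S forces Bowtie Bowtie-connected Bowtie-κ≢δ
      (λ e → bowtie-subgraph-small S S-connected triangle-free e big)

corollary1p6 : (S : Graph) → Connected S →
    ((∀ (G : Graph) → Connected G → Free S G → KappaEqDelta G) ⇔ (S ≤ᵢ P3))
corollary1p6 S S-connected =
  mk⇔ (κ≡δ-forced⇒P3-subgraph S S-connected) (P3-subgraph⇒κ≡δ S)
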